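{- Let $n\ge 2$ and let $M$ be a non-zero $n\times n$ matrix with entries in $\{0,1\}$, rows and columns indexed by $J=\{0,\dots,n-1\}$, having no row consisting entirely of ones and no column consisting entirely of ones. Then $M$ is an a-Monge matrix if and only if one of the following holds: (i) $M=L^{pq}_n$ for some $0\le p,q\le n-2$; (ii) $M=R^{st}_n$ for some $1\le s,t\le n-1$; (iii) $M=L^{pq}_n+R^{st}_n$ for some $0\le p,q\le n-2$ and $1\le s,t\le n-1$ with $p<s$ or $q<t$ (or both).
   Context: A square matrix $M$ with rows and columns indexed by $\{0,\dots,n-1\}$ is a-Monge (anti-Monge) if $M(i,s)+M(r,j)\le M(i,j)+M(r,s)$ for all $i<r$ and $j<s$, where $M(x,y)$ is the entry in row $x$, column $y$. $L^{pq}_n$ is the $n\times n$ 0-1 matrix with $L^{pq}_n(i,j)=1$ iff $i\le p$ and $j\le q$; $R^{st}_n$ is the $n\times n$ 0-1 matrix with $R^{st}_n(i,j)=1$ iff $i\ge s$ and $j\ge t$. -}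

module Defs where

open import Data.Nat using (ℕ; _+_; _≤_; _<_)
open import Data.Fin using (Fin; toℕ)
open import Data.Product using (_×_; Σ; ∃)
open import Data.Sum using (_⊎_)
open import Relation.Nullary using (¬_)
open import Relation.Binary.PropositionalEquality using (_≡_)

Matrix : ℕ → Set
Matrix n = Fin n → Fin n → ℕ

IsZeroOne : ∀ {n} → Matrix n → Set
IsZeroOne {n} M = ∀ (i j : Fin n) → (M i j ≡ 0) ⊎ (M i j ≡ 1)

NonZeroMatrix : ∀ {n} → Matrix n → Set
NonZeroMatrix {n} M = ¬ (∀ (i j : Fin n) → M i j ≡ 0)

NoAllOnesRow : ∀ {n} → Matrix n → Set
NoAllOnesRow {n} M = ∀ (i : Fin n) → ¬ (∀ (j : Fin n) → M i j ≡ 1)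

NoAllOnesCol : ∀ {n} → Matrix n → Set
NoAllOnesCol {n} M = ∀ (j : Fin n) → ¬ (∀ (i : Fin n) → M i j ≡ 1)

AMonge : ∀ {n} → Matrix n → Set
AMonge {n} M = ∀ (i r j s : Fin n) → toℕ i < toℕ r → toℕ j < toℕ s →
  M i s + M r j ≤ M i j + M r s

L : (n p q : ℕ) → Matrix n
L n p q i j with toℕ i Data.Nat.≤? p | toℕ j Data.Nat.≤? q
... | Relation.Nullary.yes _ | Relation.Nullary.yes _ = 1
... | _ | _ = 0

R : (n s t : ℕ) → Matrix n
R n s t i j with s Data.Nat.≤? toℕ i | t Data.Nat.≤? toℕ j
... | Relation.Nullary.yes _ | Relation.Nullary.yes _ = 1
... | _ | _ = 0

_⊕_ : ∀ {n} → Matrix n → Matrix n → Matrix n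
(A ⊕ B) i j = A i j + B i j

_≐_ : ∀ {n} → Matrix n → Matrix n → Set
_≐_ {n} A B = ∀ (i j : Fin n) → A i j ≡ B i j

{-# OPTIONS --safe #-}
-- Write 0 and ℓ for the first and last index.  In a 0-1 a-Monge matrix a 1 at (i , j) forces a 1
-- at (i , s) or at (r , j) whenever (r , s) lies weakly south-west or north-east of (i , j).  Taking
-- for (r , j) a zero of column j (no column is all ones) shows that the first row and column are
-- initial segments of ones, the last row and column final segments, and that every 1 is explained
-- by exactly one of the products M(i,0) M(0,j) and M(i,ℓ) M(ℓ,j).  Hence
--   M(i,j) = M(i,0) M(0,j) + M(i,ℓ) M(ℓ,j),
-- where the first summand is L^{pq} if M(0,0) = 1 and vanishes otherwise, and the second is R^{st}
-- if M(ℓ,ℓ) = 1 and vanishes otherwise; p < s or q < t since otherwise M(p,q) = 2.  Conversely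
-- L^{pq} and R^{st} are outer products of two antitone, resp. two monotone, vectors, hence a-Monge
-- by the rearrangement inequality, and sums of a-Monge matrices are a-Monge.

module Submission where

open import Defs
open import Data.Nat using (ℕ; _≤_; _<_; _∸_)
open import Data.Product using (_×_; ∃; ∃-syntax; _,_)
open import Data.Sum using (_⊎_)
open import Function.Bundles using (_⇔_)

open import Data.Empty using (⊥)
open import Data.Fin as Fin using (Fin; toℕ; fromℕ; fromℕ<)
open import Data.Fin.Properties using (toℕ-fromℕ; toℕ-fromℕ<; ≤fromℕ; ≤∧≢⇒<; ¬∀⟶∃¬)
  renaming (≤-total to Fin-≤-total)
open import Data.Nat using (zero; suc; _+_; _*_; _≥_; z≤n; s≤s; s≤s⁻¹; _≟_; _≤?_; _<?_)
open import Data.Nat.Properties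
  using ( ≤-trans; ≤-reflexive; m≤n⇒m≤1+n; <⇒≤; <⇒≱; ≮⇒≥; m≤m+n
        ; +-comm; +-mono-≤; +-identityʳ; m≤n⇒∃[o]m+o≡n )
open import Data.Nat.Tactic.RingSolver using (solve-∀)
open import Data.Product using (proj₁; proj₂)
open import Data.Sum using (inj₁; inj₂; swap)
open import Function using (_∘_)
open import Function.Bundles using (mk⇔; Equivalence)
open import Relation.Binary.Core using (_Preserves_⟶_)
open import Relation.Binary.PropositionalEquality
  using (_≡_; _≢_; refl; sym; trans; cong; cong₂; subst; subst₂)
open import Relation.Nullary using (¬_; Dec; yes; no; contradiction)
open import Relation.Nullary.Decidable using (¬?; decidable-stable)
open import Relation.Unary using (Pred; Decidable)

open Equivalence using (to; from)

IsBit : ℕ → Set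
IsBit x = x ≡ 0 ⊎ x ≡ 1

≡0⇒≢1 : ∀ {x} → x ≡ 0 → x ≢ 1
≡0⇒≢1 refl ()

bit≢1⇒≡0 : ∀ {x} → IsBit x → x ≢ 1 → x ≡ 0
bit≢1⇒≡0 (inj₁ x≡0) _   = x≡0
bit≢1⇒≡0 (inj₂ x≡1) x≢1 = contradiction x≡1 x≢1

resolveˡ : ∀ {A : Set} {x} → x ≡ 1 ⊎ A → x ≡ 0 → A
resolveˡ (inj₁ x≡1) x≡0 = contradiction x≡1 (≡0⇒≢1 x≡0)
resolveˡ (inj₂ a)   _   = a

resolveʳ : ∀ {A : Set} {x} → A ⊎ x ≡ 1 → x ≡ 0 → A
resolveʳ = resolveˡ ∘ swap

*-≡1 : ∀ {x y} → x ≡ 1 → y ≡ 1 → x * y ≡ 1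
*-≡1 refl refl = refl

bits-*-≡0 : ∀ {x y} → IsBit x → IsBit y → ¬ (x ≡ 1 × y ≡ 1) → x * y ≡ 0
bits-*-≡0 (inj₁ refl) _           _   = refl
bits-*-≡0 (inj₂ refl) (inj₁ refl) _   = refl
bits-*-≡0 (inj₂ refl) (inj₂ refl) ¬11 = contradiction (refl , refl) ¬11

bits-sum-pos : ∀ {a b c d} → IsBit c → IsBit d → a ≡ 1 → a + b ≤ c + d → c ≡ 1 ⊎ d ≡ 1
bits-sum-pos (inj₂ refl) _           _    _  = inj₁ refl
bits-sum-pos (inj₁ refl) (inj₂ refl) _    _  = inj₂ refl
bits-sum-pos (inj₁ refl) (inj₁ refl) refl ()

bits-sum-two : ∀ {a b c d} → IsBit c → IsBit d → a ≡ 1 → b ≡ 1 → a + b ≤ c + d → c ≡ 1 × d ≡ 1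
bits-sum-two (inj₂ refl) (inj₂ refl) _    _    _        = refl , refl
bits-sum-two (inj₂ refl) (inj₁ refl) refl refl (s≤s ())
bits-sum-two (inj₁ refl) (inj₂ refl) refl refl (s≤s ())
bits-sum-two (inj₁ refl) (inj₁ refl) refl refl ()

indicator : ∀ {A : Set} → Dec A → ℕ
indicator (yes _) = 1
indicator (no _)  = 0

indicator-yes : ∀ {A : Set} → A → (d : Dec A) → indicator d ≡ 1
indicator-yes _ (yes _) = refl
indicator-yes a (no ¬a) = contradiction a ¬a

indicator-mono : ∀ {A B : Set} → (A → B) → (a : Dec A) (b : Dec B) → indicator a ≤ indicator b
indicator-mono _   (yes _) (yes _) = s≤s z≤n
indicator-mono A⇒B (yes a) (no ¬b) = contradiction (A⇒B a) ¬b
indicator-mono _   (no _)  _       = z≤n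

bit≡indicator : ∀ {A : Set} {x} → IsBit x → (x ≡ 1 ⇔ A) → (d : Dec A) → x ≡ indicator d
bit≡indicator _   x≡1⇔A (yes a) = from x≡1⇔A a
bit≡indicator bit x≡1⇔A (no ¬a) = bit≢1⇒≡0 bit (¬a ∘ to x≡1⇔A)

L-indicator : ∀ n p q (i j : Fin n) →
  L n p q i j ≡ indicator (toℕ i ≤? p) * indicator (toℕ j ≤? q)
L-indicator n p q i j with toℕ i ≤? p | toℕ j ≤? q
... | yes _ | yes _ = refl
... | yes _ | no _  = refl
... | no _  | _     = refl

R-indicator : ∀ n s t (i j : Fin n) →
  R n s t i j ≡ indicator (s ≤? toℕ i) * indicator (t ≤? toℕ j)
R-indicator n s t i j with s ≤? toℕ i | t ≤? toℕ j
... | yes _ | yes _ = refl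
... | yes _ | no _  = refl
... | no _  | _     = refl

rearrangement : ∀ {a b c d} → b ≤ a → d ≤ c → a * d + b * c ≤ a * c + b * d
rearrangement {b = b} {d = d} b≤a d≤c with m≤n⇒∃[o]m+o≡n b≤a | m≤n⇒∃[o]m+o≡n d≤c
... | x , refl | y , refl =
  subst (((b + x) * d + b * (d + y)) ≤_) (gap b x d y) (m≤m+n _ (x * y))
  where
  gap : ∀ b x d y → ((b + x) * d + b * (d + y)) + x * y ≡ (b + x) * (d + y) + b * d
  gap = solve-∀

_⊗_ : ∀ {n} → (Fin n → ℕ) → (Fin n → ℕ) → Matrix n
(f ⊗ g) i j = f i * g j

⊗-aMonge-antitone : ∀ {n} {f g : Fin n → ℕ} →
  f Preserves Fin._<_ ⟶ _≥_ → g Preserves Fin._<_ ⟶ _≥_ → AMonge (f ⊗ g)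
⊗-aMonge-antitone f↓ g↓ i r j s i<r j<s = rearrangement (f↓ i<r) (g↓ j<s)

⊗-aMonge-monotone : ∀ {n} {f g : Fin n → ℕ} →
  f Preserves Fin._<_ ⟶ _≤_ → g Preserves Fin._<_ ⟶ _≤_ → AMonge (f ⊗ g)
⊗-aMonge-monotone {f = f} {g} f↑ g↑ i r j s i<r j<s =
  subst₂ _≤_ (+-comm (f r * g j) (f i * g s)) (+-comm (f r * g s) (f i * g j))
    (rearrangement (f↑ i<r) (g↑ j<s))

aMonge-resp-≐ : ∀ {n} {A B : Matrix n} → A ≐ B → AMonge A → AMonge B
aMonge-resp-≐ A≐B mon i r j s i<r j<s =
  subst₂ _≤_ (cong₂ _+_ (A≐B i s) (A≐B r j)) (cong₂ _+_ (A≐B i j) (A≐B r s))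
    (mon i r j s i<r j<s)

⊕-aMonge : ∀ {n} {A B : Matrix n} → AMonge A → AMonge B → AMonge (A ⊕ B)
⊕-aMonge {A = A} {B} monA monB i r j s i<r j<s =
  subst₂ _≤_ (interchange (A i s) (A r j) (B i s) (B r j))
             (interchange (A i j) (A r s) (B i j) (B r s))
    (+-mono-≤ (monA i r j s i<r j<s) (monB i r j s i<r j<s))
  where
  interchange : ∀ a b c d → (a + b) + (c + d) ≡ (a + c) + (b + d)
  interchange = solve-∀

L-aMonge : ∀ n p q → AMonge (L n p q)
L-aMonge n p q =
  aMonge-resp-≐ (λ i j → sym (L-indicator n p q i j)) (⊗-aMonge-antitone (down p) (down q))
  where
  down : ∀ c → (λ (i : Fin n) → indicator (toℕ i ≤? c)) Preserves Fin._<_ ⟶ _≥_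
  down c i<r = indicator-mono (≤-trans (<⇒≤ i<r)) _ _

R-aMonge : ∀ n s t → AMonge (R n s t)
R-aMonge n s t =
  aMonge-resp-≐ (λ i j → sym (R-indicator n s t i j)) (⊗-aMonge-monotone (up s) (up t))
  where
  up : ∀ c → (λ (i : Fin n) → indicator (c ≤? toℕ i)) Preserves Fin._<_ ⟶ _≤_
  up c i<r = indicator-mono (λ c≤i → ≤-trans c≤i (<⇒≤ i<r)) _ _

downClosed⇒initialSegment : ∀ {n ℓ} {P : Pred (Fin n) ℓ} → Decidable P →
  (∀ {i r} → i Fin.≤ r → P r → P i) → ∃[ c ] (∀ i → P i ⇔ toℕ i < c)
downClosed⇒initialSegment {zero} _ _ = 0 , λ ()
downClosed⇒initialSegment {suc n} {P = P} P? down with P? Fin.zero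
... | no ¬P₀ = 0 , λ i → mk⇔ (λ Pi → contradiction (down z≤n Pi) ¬P₀) (λ ())
... | yes P₀
  with downClosed⇒initialSegment {P = P ∘ Fin.suc} (P? ∘ Fin.suc) (λ i≤r → down (s≤s i≤r))
...   | c , P∘suc⇔<c = suc c , λ where
  Fin.zero    → mk⇔ (λ _ → s≤s z≤n) (λ _ → P₀)
  (Fin.suc i) → mk⇔ (s≤s ∘ to (P∘suc⇔<c i)) (from (P∘suc⇔<c i) ∘ s≤s⁻¹)

upClosed⇒finalSegment : ∀ {n ℓ} {P : Pred (Fin n) ℓ} → Decidable P →
  (∀ {i r} → i Fin.≤ r → P i → P r) → ∃[ c ] (∀ i → P i ⇔ c ≤ toℕ i)
upClosed⇒finalSegment {P = P} P? up
  with downClosed⇒initialSegment {P = ¬_ ∘ P} (¬? ∘ P?) (λ i≤r ¬Pr Pi → ¬Pr (up i≤r Pi))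
... | c , ¬P⇔<c = c , λ i → mk⇔
  (λ Pi → ≮⇒≥ (λ i<c → from (¬P⇔<c i) i<c Pi))
  (λ c≤i → decidable-stable (P? i) (λ ¬Pi → <⇒≱ (to (¬P⇔<c i) ¬Pi) c≤i))

prefix-indicator : ∀ {m} (u : Fin (suc (suc m)) → ℕ) → (∀ i → IsBit (u i)) →
  (∀ {i r} → i Fin.≤ r → u r ≡ 1 → u i ≡ 1) → u Fin.zero ≡ 1 → u (fromℕ (suc m)) ≡ 0 →
  ∃[ p ] (p ≤ m × ∀ i → u i ≡ indicator (toℕ i ≤? p))
prefix-indicator {m} u bit down u₀≡1 uₗ≡0 with downClosed⇒initialSegment (λ i → u i ≟ 1) down
... | zero  , u≡1⇔<0 = contradiction (to (u≡1⇔<0 Fin.zero) u₀≡1) λ ()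
... | suc p , u≡1⇔≤p = p , s≤s⁻¹ (≮⇒≥ last∉) , λ i →
  bit≡indicator (bit i) (mk⇔ (s≤s⁻¹ ∘ to (u≡1⇔≤p i)) (from (u≡1⇔≤p i) ∘ s≤s)) (toℕ i ≤? p)
  where
  last∉ : ¬ suc m < suc p
  last∉ m<p = ≡0⇒≢1 uₗ≡0
    (from (u≡1⇔≤p (fromℕ (suc m))) (subst (_< suc p) (sym (toℕ-fromℕ (suc m))) m<p))

suffix-indicator : ∀ {m} (u : Fin (suc (suc m)) → ℕ) → (∀ i → IsBit (u i)) →
  (∀ {i r} → i Fin.≤ r → u i ≡ 1 → u r ≡ 1) → u Fin.zero ≡ 0 → u (fromℕ (suc m)) ≡ 1 →
  ∃[ s ] (1 ≤ s × s ≤ suc m × ∀ i → u i ≡ indicator (s ≤? toℕ i))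
suffix-indicator {m} u bit up u₀≡0 uₗ≡1 with upClosed⇒finalSegment (λ i → u i ≟ 1) up
... | zero  , u≡1⇔0≤ = contradiction (from (u≡1⇔0≤ Fin.zero) z≤n) (≡0⇒≢1 u₀≡0)
... | suc s , u≡1⇔s≤ = suc s , s≤s z≤n
  , subst (suc s ≤_) (toℕ-fromℕ (suc m)) (to (u≡1⇔s≤ (fromℕ (suc m))) uₗ≡1)
  , λ i → bit≡indicator (bit i) (u≡1⇔s≤ i) (suc s ≤? toℕ i)

_ᵀ : ∀ {n} → Matrix n → Matrix n
(M ᵀ) i j = M j i

ᵀ-aMonge : ∀ {n} {M : Matrix n} → AMonge M → AMonge (M ᵀ)
ᵀ-aMonge {M = M} mon i r j s i<r j<s =
  subst₂ _≤_ (+-comm (M j r) (M s i)) refl (mon j s i r j<s i<r)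

module _ {n} {M : Matrix n} (bit : IsZeroOne M) (mon : AMonge M) where

  one-spreads-SW : ∀ {i j r s} → i Fin.≤ r → s Fin.≤ j → M i j ≡ 1 → M i s ≡ 1 ⊎ M r j ≡ 1
  one-spreads-SW {i} {j} {r} {s} i≤r s≤j Mij≡1 with i Fin.≟ r | s Fin.≟ j
  ... | yes refl | _        = inj₂ Mij≡1
  ... | _        | yes refl = inj₁ Mij≡1
  ... | no i≢r   | no s≢j   =
    bits-sum-pos (bit i s) (bit r j) Mij≡1 (mon i r s j (≤∧≢⇒< i≤r i≢r) (≤∧≢⇒< s≤j s≢j))

  fill-through : ∀ {i j k} → (i Fin.≤ k × j Fin.≤ k) ⊎ (k Fin.≤ i × k Fin.≤ j) →
    M i k ≡ 1 → M k j ≡ 1 → M i j ≡ 1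
  fill-through {i} {j} {k} side Mik≡1 Mkj≡1 with i Fin.≟ k | j Fin.≟ k | side
  ... | yes refl | _        | _                = Mkj≡1
  ... | _        | yes refl | _                = Mik≡1
  ... | no i≢k   | no j≢k   | inj₁ (i≤k , j≤k) = proj₁ (bits-sum-two (bit i j) (bit k k) Mik≡1 Mkj≡1
    (mon i k j k (≤∧≢⇒< i≤k i≢k) (≤∧≢⇒< j≤k j≢k)))
  ... | no i≢k   | no j≢k   | inj₂ (k≤i , k≤j) = proj₂ (bits-sum-two (bit k k) (bit i j) Mkj≡1 Mik≡1
    (mon k i k j (≤∧≢⇒< k≤i (i≢k ∘ sym)) (≤∧≢⇒< k≤j (j≢k ∘ sym))))

one-spreads-NE : ∀ {n} {M : Matrix n} → IsZeroOne M → AMonge M →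
  ∀ {i j r s} → r Fin.≤ i → j Fin.≤ s → M i j ≡ 1 → M i s ≡ 1 ⊎ M r j ≡ 1
one-spreads-NE {M = M} bit mon r≤i j≤s Mij≡1 =
  swap (one-spreads-SW {M = M ᵀ} (λ i j → bit j i) (ᵀ-aMonge {M = M} mon) j≤s r≤i Mij≡1)

module BoundaryRows {m} {M : Matrix (suc (suc m))} (bit : IsZeroOne M) (mon : AMonge M)
                    (row : NoAllOnesRow M) (col : NoAllOnesCol M) where

  n : ℕ
  n = suc (suc m)

  first last : Fin n
  first = Fin.zero
  last  = fromℕ (suc m)

  zeroInColumn : ∀ j → ∃[ r ] M r j ≡ 0
  zeroInColumn j with ¬∀⟶∃¬ _ (λ r → M r j ≡ 1) (λ r → M r j ≟ 1) (col j)
  ... | r , Mrj≢1 = r , bit≢1⇒≡0 (bit r j) Mrj≢1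

  firstRow-downClosed : ∀ {j s} → j Fin.≤ s → M first s ≡ 1 → M first j ≡ 1
  firstRow-downClosed {s = s} j≤s M₀s≡1 with zeroInColumn s
  ... | r , Mrs≡0 = resolveʳ (one-spreads-SW bit mon z≤n j≤s M₀s≡1) Mrs≡0

  lastRow-upClosed : ∀ {j s} → j Fin.≤ s → M last j ≡ 1 → M last s ≡ 1
  lastRow-upClosed {j} j≤s Mₗj≡1 with zeroInColumn j
  ... | r , Mrj≡0 = resolveʳ (one-spreads-NE bit mon (≤fromℕ r) j≤s Mₗj≡1) Mrj≡0

  firstRow-last : M first last ≡ 0
  firstRow-last = bit≢1⇒≡0 (bit first last) λ M₀ₗ≡1 →
    row first λ j → firstRow-downClosed (≤fromℕ j) M₀ₗ≡1

  rowEnds-one : ∀ {i j} → M i j ≡ 1 → M i first ≡ 1 ⊎ M i last ≡ 1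
  rowEnds-one {i} {j} Mij≡1 with zeroInColumn j
  ... | r , Mrj≡0 with Fin-≤-total i r
  ...   | inj₁ i≤r = inj₁ (resolveʳ (one-spreads-SW bit mon i≤r z≤n Mij≡1) Mrj≡0)
  ...   | inj₂ r≤i = inj₂ (resolveʳ (one-spreads-NE bit mon r≤i (≤fromℕ j) Mij≡1) Mrj≡0)

  through-first : ∀ {i j} → M i first ≡ 1 → M first j ≡ 1 → M i j ≡ 1
  through-first = fill-through bit mon (inj₂ (z≤n , z≤n))

  through-last : ∀ {i j} → M i last ≡ 1 → M last j ≡ 1 → M i j ≡ 1
  through-last {i} {j} = fill-through bit mon (inj₁ (≤fromℕ i , ≤fromℕ j))

IsL IsR IsL⊕R : ∀ n → Matrix n → Set
IsL n M = ∃[ p ] ∃[ q ] (p ≤ n ∸ 2 × q ≤ n ∸ 2 × M ≐ L n p q)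
IsR n M = ∃[ s ] ∃[ t ] (1 ≤ s × s ≤ n ∸ 1 × 1 ≤ t × t ≤ n ∸ 1 × M ≐ R n s t)
IsL⊕R n M = ∃[ p ] ∃[ q ] ∃[ s ] ∃[ t ]
  (p ≤ n ∸ 2 × q ≤ n ∸ 2 × 1 ≤ s × s ≤ n ∸ 1 × 1 ≤ t × t ≤ n ∸ 1
   × (p < s ⊎ q < t) × M ≐ (L n p q ⊕ R n s t))

shape⇒aMonge : ∀ {n} {M : Matrix n} → IsL n M ⊎ IsR n M ⊎ IsL⊕R n M → AMonge M
shape⇒aMonge {n} (inj₁ (p , q , _ , _ , M≐L)) =
  aMonge-resp-≐ (λ i j → sym (M≐L i j)) (L-aMonge n p q)
shape⇒aMonge {n} (inj₂ (inj₁ (s , t , _ , _ , _ , _ , M≐R))) =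
  aMonge-resp-≐ (λ i j → sym (M≐R i j)) (R-aMonge n s t)
shape⇒aMonge {n} (inj₂ (inj₂ (p , q , s , t , _ , _ , _ , _ , _ , _ , _ , M≐L⊕R))) =
  aMonge-resp-≐ (λ i j → sym (M≐L⊕R i j))
    (⊕-aMonge {A = L n p q} {R n s t} (L-aMonge n p q) (R-aMonge n s t))

L⊕R-separated : ∀ {n p q s t} {M : Matrix n} → IsZeroOne M → M ≐ (L n p q ⊕ R n s t) →
  p < n → q < n → p < s ⊎ q < t
L⊕R-separated {n} {p} {q} {s} {t} bit M≐L⊕R p<n q<n with p <? s | q <? t
... | yes p<s | _       = inj₁ p<s
... | no _    | yes q<t = inj₂ q<t
... | no p≮s  | no q≮t  =
  contradiction (trans (M≐L⊕R î ĵ) (cong₂ _+_ inL inR)) (not-two (bit î ĵ))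
  where
  î = fromℕ< p<n
  ĵ = fromℕ< q<n
  î≡p : toℕ î ≡ p
  î≡p = toℕ-fromℕ< p<n
  ĵ≡q : toℕ ĵ ≡ q
  ĵ≡q = toℕ-fromℕ< q<n
  inL : L n p q î ĵ ≡ 1
  inL = trans (L-indicator n p q î ĵ) (cong₂ _*_
    (indicator-yes (≤-reflexive î≡p) (toℕ î ≤? p))
    (indicator-yes (≤-reflexive ĵ≡q) (toℕ ĵ ≤? q)))
  inR : R n s t î ĵ ≡ 1
  inR = trans (R-indicator n s t î ĵ) (cong₂ _*_
    (indicator-yes (subst (s ≤_) (sym î≡p) (≮⇒≥ p≮s)) (s ≤? toℕ î))
    (indicator-yes (subst (t ≤_) (sym ĵ≡q) (≮⇒≥ q≮t)) (t ≤? toℕ ĵ)))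
  not-two : ∀ {x} → IsBit x → x ≢ 2
  not-two (inj₁ refl) ()
  not-two (inj₂ refl) ()

module Classification {m} {M : Matrix (suc (suc m))} (bit : IsZeroOne M) (mon : AMonge M)
                      (row : NoAllOnesRow M) (col : NoAllOnesCol M) where

  open BoundaryRows bit mon row col

  private
    module Transposed = BoundaryRows {M = M ᵀ} (λ i j → bit j i) (ᵀ-aMonge {M = M} mon) col row

  firstColumn-downClosed : ∀ {i r} → i Fin.≤ r → M r first ≡ 1 → M i first ≡ 1
  firstColumn-downClosed = Transposed.firstRow-downClosed

  lastColumn-upClosed : ∀ {i r} → i Fin.≤ r → M i last ≡ 1 → M r last ≡ 1
  lastColumn-upClosed = Transposed.lastRow-upClosed

  firstColumn-last : M last first ≡ 0
  firstColumn-last = Transposed.firstRow-last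

  columnEnds-one : ∀ {i j} → M i j ≡ 1 → M first j ≡ 1 ⊎ M last j ≡ 1
  columnEnds-one = Transposed.rowEnds-one

  zeroInRow : ∀ i → ∃[ c ] M i c ≡ 0
  zeroInRow = Transposed.zeroInColumn

  one⇒through-first-or-last : ∀ {i j} → M i j ≡ 1 →
    (M i first ≡ 1 × M first j ≡ 1) ⊎ (M i last ≡ 1 × M last j ≡ 1)
  one⇒through-first-or-last {i} {j} Mij≡1 with bit i first | bit first j
  ... | inj₂ Mi₀≡1 | inj₂ M₀j≡1 = inj₁ (Mi₀≡1 , M₀j≡1)
  ... | inj₁ Mi₀≡0 | _          = inj₂
    ( resolveˡ (rowEnds-one Mij≡1) Mi₀≡0
    , resolveˡ (one-spreads-SW bit mon (≤fromℕ i) z≤n Mij≡1) Mi₀≡0 )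
  ... | inj₂ _     | inj₁ M₀j≡0 = inj₂
    ( resolveʳ (one-spreads-NE bit mon z≤n (≤fromℕ j) Mij≡1) M₀j≡0
    , resolveˡ (columnEnds-one Mij≡1) M₀j≡0 )

  not-through-both : ∀ {i j} →
    M i first ≡ 1 → M first j ≡ 1 → M i last ≡ 1 → M last j ≡ 1 → ⊥
  not-through-both {i} {j} Mi₀≡1 M₀j≡1 Miₗ≡1 Mₗj≡1 with zeroInRow i
  ... | c , Mic≡0 with Fin-≤-total c j
  ...   | inj₁ c≤j = ≡0⇒≢1 Mic≡0 (through-first Mi₀≡1 (firstRow-downClosed c≤j M₀j≡1))
  ...   | inj₂ j≤c = ≡0⇒≢1 Mic≡0 (through-last Miₗ≡1 (lastRow-upClosed j≤c Mₗj≡1))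

  entry≡sum : ∀ i j → M i j ≡ M i first * M first j + M i last * M last j
  entry≡sum i j with bit i j
  ... | inj₁ Mij≡0 = trans Mij≡0 (sym (cong₂ _+_
    (bits-*-≡0 (bit i first) (bit first j) λ (a , b) → ≡0⇒≢1 Mij≡0 (through-first a b))
    (bits-*-≡0 (bit i last) (bit last j) λ (c , d) → ≡0⇒≢1 Mij≡0 (through-last c d))))
  ... | inj₂ Mij≡1 with one⇒through-first-or-last Mij≡1
  ...   | inj₁ (a , b) = trans Mij≡1 (sym (cong₂ _+_
    (*-≡1 a b)
    (bits-*-≡0 (bit i last) (bit last j) λ (c , d) → not-through-both a b c d)))
  ...   | inj₂ (c , d) = trans Mij≡1 (sym (cong₂ _+_
    (bits-*-≡0 (bit i first) (bit first j) λ (a , b) → not-through-both a b c d)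
    (*-≡1 c d)))

  firstCross-zero : M first first ≡ 0 → ∀ i j → M i first * M first j ≡ 0
  firstCross-zero M₀₀≡0 i j = cong (_* M first j)
    (bit≢1⇒≡0 (bit i first) (≡0⇒≢1 M₀₀≡0 ∘ firstColumn-downClosed z≤n))

  lastCross-zero : M last last ≡ 0 → ∀ i j → M i last * M last j ≡ 0
  lastCross-zero Mₗₗ≡0 i j = cong (_* M last j)
    (bit≢1⇒≡0 (bit i last) (≡0⇒≢1 Mₗₗ≡0 ∘ lastColumn-upClosed (≤fromℕ i)))

  firstCross≐L : M first first ≡ 1 → ∃[ p ] ∃[ q ]
    (p ≤ m × q ≤ m × ∀ i j → M i first * M first j ≡ L n p q i j)
  firstCross≐L M₀₀≡1
    with prefix-indicator (λ i → M i first) (λ i → bit i first)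
           firstColumn-downClosed M₀₀≡1 firstColumn-last
       | prefix-indicator (M first) (bit first) firstRow-downClosed M₀₀≡1 firstRow-last
  ... | p , p≤m , column≡ | q , q≤m , row≡ = p , q , p≤m , q≤m , λ i j →
    trans (cong₂ _*_ (column≡ i) (row≡ j)) (sym (L-indicator n p q i j))

  lastCross≐R : M last last ≡ 1 → ∃[ s ] ∃[ t ]
    (1 ≤ s × s ≤ suc m × 1 ≤ t × t ≤ suc m × ∀ i j → M i last * M last j ≡ R n s t i j)
  lastCross≐R Mₗₗ≡1
    with suffix-indicator (λ i → M i last) (λ i → bit i last)
           lastColumn-upClosed firstRow-last Mₗₗ≡1
       | suffix-indicator (M last) (bit last) lastRow-upClosed firstColumn-last Mₗₗ≡1
  ... | s , 1≤s , s≤m+1 , column≡ | t , 1≤t , t≤m+1 , row≡ =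
    s , t , 1≤s , s≤m+1 , 1≤t , t≤m+1 , λ i j →
    trans (cong₂ _*_ (column≡ i) (row≡ j)) (sym (R-indicator n s t i j))

  classify : NonZeroMatrix M → IsL n M ⊎ IsR n M ⊎ IsL⊕R n M
  classify nonzero with bit first first | bit last last
  ... | inj₁ M₀₀≡0 | inj₁ Mₗₗ≡0 = contradiction (λ i j → trans (entry≡sum i j)
    (cong₂ _+_ (firstCross-zero M₀₀≡0 i j) (lastCross-zero Mₗₗ≡0 i j))) nonzero
  ... | inj₂ M₀₀≡1 | inj₁ Mₗₗ≡0 with firstCross≐L M₀₀≡1
  ...   | p , q , p≤m , q≤m , cross≐L = inj₁ (p , q , p≤m , q≤m , λ i j → trans (entry≡sum i j)
    (trans (cong₂ _+_ (cross≐L i j) (lastCross-zero Mₗₗ≡0 i j)) (+-identityʳ _)))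
  classify _ | inj₁ M₀₀≡0 | inj₂ Mₗₗ≡1 with lastCross≐R Mₗₗ≡1
  ...   | s , t , 1≤s , s≤m+1 , 1≤t , t≤m+1 , cross≐R =
    inj₂ (inj₁ (s , t , 1≤s , s≤m+1 , 1≤t , t≤m+1 , λ i j → trans (entry≡sum i j)
      (cong₂ _+_ (firstCross-zero M₀₀≡0 i j) (cross≐R i j))))
  classify _ | inj₂ M₀₀≡1 | inj₂ Mₗₗ≡1 with firstCross≐L M₀₀≡1 | lastCross≐R Mₗₗ≡1
  ...   | p , q , p≤m , q≤m , cross≐L | s , t , 1≤s , s≤m+1 , 1≤t , t≤m+1 , cross≐R =
    inj₂ (inj₂ (p , q , s , t , p≤m , q≤m , 1≤s , s≤m+1 , 1≤t , t≤m+1 ,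
      L⊕R-separated bit M≐L⊕R (s≤s (m≤n⇒m≤1+n p≤m)) (s≤s (m≤n⇒m≤1+n q≤m)) , M≐L⊕R))
    where
    M≐L⊕R : M ≐ (L n p q ⊕ R n s t)
    M≐L⊕R i j = trans (entry≡sum i j) (cong₂ _+_ (cross≐L i j) (cross≐R i j))

lemma4p4 : (n : ℕ) → 2 ≤ n → (M : Matrix n) →
  IsZeroOne M → NonZeroMatrix M → NoAllOnesRow M → NoAllOnesCol M →
  AMonge M ⇔
    ((∃[ p ] ∃[ q ] (p ≤ n ∸ 2 × q ≤ n ∸ 2 × M ≐ L n p q))
    ⊎ (∃[ s ] ∃[ t ] (1 ≤ s × s ≤ n ∸ 1 × 1 ≤ t × t ≤ n ∸ 1 × M ≐ R n s t))
    ⊎ (∃[ p ] ∃[ q ] ∃[ s ] ∃[ t ]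
        (p ≤ n ∸ 2 × q ≤ n ∸ 2 × 1 ≤ s × s ≤ n ∸ 1 × 1 ≤ t × t ≤ n ∸ 1
         × (p < s ⊎ q < t) × M ≐ (L n p q ⊕ R n s t))))
lemma4p4 1 (s≤s ()) _ _ _ _ _
lemma4p4 (suc (suc m)) _ M bit nonzero row col =
  mk⇔ (λ mon → Classification.classify bit mon row col nonzero) shape⇒aMonge
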